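{- Let $p$ be a prime and $d\geq 1$, and let $e_{d,1},\dots,e_{d,n}$ be the (eventually zero) exponents of $\mathcal{H}_{p,d}(x)=\prod_{i=1}^n(\mathcal{G}_{p,i}(x))^{e_{d,i}}$. Then $\omega_1(p^d)=\sum_{i=1}^n e_{d,i}p^i=p\sum_{i=1}^n e_{d,i}p^{i-1}$.
   Context: An integer polynomial $f$ is a null polynomial modulo $m$ if $f(x)\equiv 0 \pmod m$ for every integer $x$; a monic null polynomial of degree $n$ modulo $m$ is one coefficientwise congruent modulo $m$ to a monic polynomial of degree $n$. $\omega_1(m)$ is the least $n\geq 1$ for which a monic null polynomial of degree $n$ modulo $m$ exists. For a prime $p$: $I_p(0)=0$, $I_p(n)=\frac{p^n-1}{p-1}$ ($n\ge1$); $\mathcal{G}_{p,0}(x)=x$, $\mathcal{G}_{p,n}(x)=\prod_{i=0}^{p-1}\left(\mathcal{G}_{p,n-1}(x)-ip^{I_p(n-1)}\right)$ for $n\geq 1$. Exponents $(e_{d,i})_{i\geq1}$ are defined recursively: $e_{0,i}=0$; for $d\geq 1$, if $\max_i e_{d-1,i}\leq p-1$ then $e_{d,1}=e_{d-1,1}+1$ and the others are unchanged; otherwise there is $i$ with $e_{d-1,i}=p$ and $e_{d-1,1}=\cdots=e_{d-1,i-1}=0$, and then $e_{d,i}=0$, $e_{d,i+1}=e_{d-1,i+1}+1$, others unchanged. $\mathcal{H}_{p,d}(x)=\prod_{i\geq 1}(\mathcal{G}_{p,i}(x))^{e_{d,i}}$. -}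

module Defs where

open import Data.Nat as ℕ using (ℕ; zero; suc; _≤_; _<_; _∸_)
open import Data.Integer as ℤ using (ℤ; +_)
open import Data.Integer.Divisibility using (_∣_)
open import Data.List using (List; []; _∷_)
open import Data.Product using (Σ; _×_; ∃)
open import Data.Bool using (Bool; true; false)
open import Relation.Nullary using (¬_; does)
open import Relation.Binary.PropositionalEquality using (_≡_)

-- Integer polynomials as coefficient lists (constant term first).

Poly : Set
Poly = List ℤ

coeff : Poly → ℕ → ℤ
coeff []       _       = + 0
coeff (a ∷ f)  zero    = a
coeff (a ∷ f)  (suc k) = coeff f k

eval : Poly → ℤ → ℤ
eval []      x = + 0
eval (a ∷ f) x = a ℤ.+ x ℤ.* eval f x

IsNullMod : ℕ → Poly → Set
IsNullMod m f = ∀ (x : ℤ) → (+ m) ∣ eval f x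

IsMonicOfDegree : ℕ → Poly → Set
IsMonicOfDegree n g = coeff g n ≡ + 1 × (∀ k → n < k → coeff g k ≡ + 0)

CoeffCong : ℕ → Poly → Poly → Set
CoeffCong m f g = ∀ k → (+ m) ∣ (coeff f k ℤ.- coeff g k)

IsMonicNullMod : ℕ → ℕ → Poly → Set
IsMonicNullMod m n f =
  IsNullMod m f × Σ Poly (λ g → IsMonicOfDegree n g × CoeffCong m f g)

HasMonicNull : ℕ → ℕ → Set
HasMonicNull m n = ∃ λ f → IsMonicNullMod m n f

IsOmega1 : ℕ → ℕ → Set
IsOmega1 m k =
  1 ≤ k × HasMonicNull m k × (∀ n → 1 ≤ n → n < k → ¬ HasMonicNull m n)

-- The exponents e_{d,i}.  A state is a list whose j-th entry (j = 0,1,..)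
-- is e_{d,j+1}; entries beyond the list are 0.

incHead : List ℕ → List ℕ
incHead []       = 1 ∷ []
incHead (x ∷ xs) = suc x ∷ xs

allLe : ℕ → List ℕ → Bool
allLe b []       = true
allLe b (x ∷ xs) with does (x ℕ.≤? b)
... | true  = allLe b xs
... | false = false

-- carry step: find the first nonzero entry (index i); it equals p
-- (preceding entries are 0); set it to 0 and increment entry i+1.
-- (The remaining clauses are unreachable from the recursion.)
carry : ℕ → List ℕ → List ℕ
carry p []       = []
carry p (zero ∷ xs) = zero ∷ carry p xs
carry p (suc x ∷ xs) with does (suc x ℕ.≟ p)
... | true  = zero ∷ incHead xs
... | false = suc x ∷ xs

stepE : ℕ → List ℕ → List ℕ
stepE p es with allLe (p ∸ 1) es
... | true  = incHead es
... | false = carry p es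

e : ℕ → ℕ → List ℕ
e p zero    = []
e p (suc d) = stepE p (e p d)

weightedFrom : ℕ → ℕ → List ℕ → ℕ
weightedFrom p s []       = 0
weightedFrom p s (x ∷ xs) = x ℕ.* p ℕ.^ s ℕ.+ weightedFrom p (suc s) xs

sumEP : ℕ → List ℕ → ℕ
sumEP p es = weightedFrom p 1 es

sumEP' : ℕ → List ℕ → ℕ
sumEP' p es = weightedFrom p 0 es

-- ω₁(m) is the least N ≥ 1 with m ∣ N!.  The falling factorial x(x-1)⋯(x-N+1) is a monic null
-- polynomial modulo N!.  Conversely, expand a monic g of degree N in falling factorials: N finite
-- differences turn g into the constant N!, and finite differences of a null function stay null.
-- For m = p^d this asks for the least N with d ≤ ν(N), where p^ν(N) exactly divides N!.
-- Legendre's recursion ν(pq + r) = q + ν(q) for r < p gives ν(p · Σ eᵢ p^(i-1)) ≥ Σ eᵢ I_p(i),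
-- with equality when every eᵢ < p.  Along the recursion for e_{d,·} one has Σ e_{d,i} I_p(i) = d,
-- and deg 𝓗_{p,d} = p · Σ e_{d,i} p^(i-1) either grows by p from a state with all entries < p,
-- in which case ν(deg 𝓗_{p,d} - 1) = d - 1, or is left unchanged by a carry.  So no N < deg 𝓗_{p,d}
-- has d ≤ ν(N).

module Submission where

open import Data.Nat using (ℕ; suc; 2+)
open import Data.Nat.Primality using (Prime)
open import Defs

module NullPolynomials where

  open import Data.Nat as ℕ using (ℕ; zero; suc; _!; _<_; z≤n; s≤s)
  import Data.Nat.Properties as ℕ
  import Data.Nat.Divisibility as ℕ
  open import Data.Integer using (ℤ; +_; -[1+_]; 0ℤ; 1ℤ; _+_; _-_; _*_; -_)
  open import Data.Integer.Properties
    using (+-identityˡ; +-identityʳ; *-identityˡ; *-identityʳ; *-zeroʳ; +-inverseʳ; pos-*; *-assoc)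
  open import Data.Integer.Divisibility.Signed
    using (_∣_; ∣ᵤ⇒∣; ∣⇒∣ᵤ; ∣-trans; ∣m∣n⇒∣m+n; ∣m∣n⇒∣m-n; ∣n⇒∣m*n; *-monoʳ-∣)
  open import Data.Integer.Tactic.RingSolver using (solve-∀)
  open import Data.List using ([]; _∷_)
  open import Data.Product using (_,_; proj₁; proj₂)
  open import Data.Sum using (inj₁; inj₂)
  open import Function using (_∘_)
  open import Relation.Nullary using (¬_)
  open import Relation.Binary.PropositionalEquality
    using (_≡_; refl; sym; trans; cong; cong₂; subst; subst₂; module ≡-Reasoning)
  open ≡-Reasoning

  ∣0 : ∀ m → m ∣ 0ℤ
  ∣0 m = record { quotient = 0ℤ ; equality = refl }

  infixl 6 _⊕_
  infixr 7 _•_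

  _⊕_ : Poly → Poly → Poly
  []      ⊕ g       = g
  (a ∷ f) ⊕ []      = a ∷ f
  (a ∷ f) ⊕ (b ∷ g) = a + b ∷ f ⊕ g

  _•_ : ℤ → Poly → Poly
  c • []      = []
  c • (a ∷ f) = c * a ∷ c • f

  coeff-⊕ : ∀ f g k → coeff (f ⊕ g) k ≡ coeff f k + coeff g k
  coeff-⊕ []      g       k       = sym (+-identityˡ _)
  coeff-⊕ (a ∷ f) []      k       = sym (+-identityʳ _)
  coeff-⊕ (a ∷ f) (b ∷ g) zero    = refl
  coeff-⊕ (a ∷ f) (b ∷ g) (suc k) = coeff-⊕ f g k

  eval-⊕ : ∀ f g x → eval (f ⊕ g) x ≡ eval f x + eval g x
  eval-⊕ []      g       x = sym (+-identityˡ _)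
  eval-⊕ (a ∷ f) []      x = sym (+-identityʳ _)
  eval-⊕ (a ∷ f) (b ∷ g) x =
    trans (cong (λ v → a + b + x * v) (eval-⊕ f g x)) (ring a b x (eval f x) (eval g x))
    where
    ring : ∀ a b x u v → a + b + x * (u + v) ≡ a + x * u + (b + x * v)
    ring = solve-∀

  coeff-• : ∀ c f k → coeff (c • f) k ≡ c * coeff f k
  coeff-• c []      k       = sym (*-zeroʳ c)
  coeff-• c (a ∷ f) zero    = refl
  coeff-• c (a ∷ f) (suc k) = coeff-• c f k

  eval-• : ∀ c f x → eval (c • f) x ≡ c * eval f x
  eval-• c []      x = sym (*-zeroʳ c)
  eval-• c (a ∷ f) x = trans (cong (λ v → c * a + x * v) (eval-• c f x)) (ring c a x (eval f x))
    where
    ring : ∀ c a x u → c * a + x * (c * u) ≡ c * (a + x * u)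
    ring = solve-∀

  eval-zero : ∀ g → (∀ k → coeff g k ≡ 0ℤ) → ∀ x → eval g x ≡ 0ℤ
  eval-zero []      _    x = refl
  eval-zero (b ∷ g) all0 x = begin
    b + x * eval g x ≡⟨ cong₂ (λ b u → b + x * u) (all0 0) (eval-zero g (λ k → all0 (suc k)) x) ⟩
    0ℤ + x * 0ℤ      ≡⟨ cong (λ v → 0ℤ + v) (*-zeroʳ x) ⟩
    0ℤ               ∎

  eval-constant : ∀ g → (∀ j → 0 < j → coeff g j ≡ 0ℤ) → ∀ x → eval g x ≡ coeff g 0
  eval-constant []      _    x = refl
  eval-constant (a ∷ g) high x = begin
    a + x * eval g x ≡⟨ cong (λ v → a + x * v) (eval-zero g (λ k → high (suc k) (s≤s z≤n)) x) ⟩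
    a + x * 0ℤ       ≡⟨ cong (λ v → a + v) (*-zeroʳ x) ⟩
    a + 0ℤ           ≡⟨ +-identityʳ a ⟩
    a                ∎

  coeffCong⇒∣ : ∀ m f g → CoeffCong m f g → ∀ k → + m ∣ coeff f k - coeff g k
  coeffCong⇒∣ m f g f≡g k = ∣ᵤ⇒∣ (f≡g k)

  coeffCong⇒eval∣ : ∀ m f g → CoeffCong m f g → ∀ x → + m ∣ eval f x - eval g x
  coeffCong⇒eval∣ m []      []      _   x = ∣0 (+ m)
  coeffCong⇒eval∣ m (a ∷ f) (b ∷ g) f≡g x =
    subst (+ m ∣_) (ring a b x (eval f x) (eval g x))
      (∣m∣n⇒∣m+n (coeffCong⇒∣ m (a ∷ f) (b ∷ g) f≡g 0)
                  (∣n⇒∣m*n x (coeffCong⇒eval∣ m f g (λ k → f≡g (suc k)) x)))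
    where
    ring : ∀ a b x u v → a - b + x * (u - v) ≡ a + x * u - (b + x * v)
    ring = solve-∀
  coeffCong⇒eval∣ m []      (b ∷ g) f≡g x =
    subst (+ m ∣_) (ring b x (eval g x))
      (∣m∣n⇒∣m+n (coeffCong⇒∣ m [] (b ∷ g) f≡g 0)
                  (∣n⇒∣m*n x (coeffCong⇒eval∣ m [] g (λ k → f≡g (suc k)) x)))
    where
    ring : ∀ b x v → 0ℤ - b + x * (0ℤ - v) ≡ 0ℤ - (b + x * v)
    ring = solve-∀
  coeffCong⇒eval∣ m (a ∷ f) []      f≡g x =
    subst (+ m ∣_) (ring a x (eval f x))
      (∣m∣n⇒∣m+n (coeffCong⇒∣ m (a ∷ f) [] f≡g 0)
                  (∣n⇒∣m*n x (coeffCong⇒eval∣ m f [] (λ k → f≡g (suc k)) x)))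
    where
    ring : ∀ a x u → a - 0ℤ + x * (u - 0ℤ) ≡ a + x * u - 0ℤ
    ring = solve-∀

  falling : ℕ → ℤ → ℤ
  falling zero    x = 1ℤ
  falling (suc n) x = falling n x * (x - + n)

  fallingPoly : ℕ → Poly
  fallingPoly zero    = 1ℤ ∷ []
  fallingPoly (suc n) = (0ℤ ∷ fallingPoly n) ⊕ - + n • fallingPoly n

  eval-fallingPoly : ∀ n x → eval (fallingPoly n) x ≡ falling n x
  eval-fallingPoly zero    x = ring x
    where
    ring : ∀ x → 1ℤ + x * 0ℤ ≡ 1ℤ
    ring = solve-∀
  eval-fallingPoly (suc n) x = begin
    eval ((0ℤ ∷ fallingPoly n) ⊕ - + n • fallingPoly n) x
      ≡⟨ eval-⊕ (0ℤ ∷ fallingPoly n) (- + n • fallingPoly n) x ⟩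
    0ℤ + x * eval (fallingPoly n) x + eval (- + n • fallingPoly n) x
      ≡⟨ cong (λ v → 0ℤ + x * eval (fallingPoly n) x + v) (eval-• (- + n) (fallingPoly n) x) ⟩
    0ℤ + x * eval (fallingPoly n) x + - + n * eval (fallingPoly n) x
      ≡⟨ cong (λ v → 0ℤ + x * v + - + n * v) (eval-fallingPoly n x) ⟩
    0ℤ + x * falling n x + - + n * falling n x
      ≡⟨ ring x (+ n) (falling n x) ⟩
    falling n x * (x - + n) ∎
    where
    ring : ∀ x a q → 0ℤ + x * q + - a * q ≡ q * (x - a)
    ring = solve-∀

  fallingPoly-monic : ∀ n → IsMonicOfDegree n (fallingPoly n)
  fallingPoly-monic zero    = refl , λ { (suc k) _ → refl }
  fallingPoly-monic (suc n) = top , high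
    where
    coeff-step : ∀ k → coeff (fallingPoly (suc n)) (suc k)
                     ≡ coeff (fallingPoly n) k + - + n * coeff (fallingPoly n) (suc k)
    coeff-step k = trans (coeff-⊕ (0ℤ ∷ fallingPoly n) (- + n • fallingPoly n) (suc k))
                         (cong (λ v → coeff (fallingPoly n) k + v) (coeff-• (- + n) (fallingPoly n) (suc k)))
    top : coeff (fallingPoly (suc n)) (suc n) ≡ 1ℤ
    top = begin
      coeff (fallingPoly (suc n)) (suc n) ≡⟨ coeff-step n ⟩
      coeff (fallingPoly n) n + - + n * coeff (fallingPoly n) (suc n)
        ≡⟨ cong₂ (λ a b → a + - + n * b) (proj₁ (fallingPoly-monic n))
                 (proj₂ (fallingPoly-monic n) (suc n) (ℕ.n<1+n n)) ⟩
      1ℤ + - + n * 0ℤ ≡⟨ ring (+ n) ⟩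
      1ℤ ∎
      where
      ring : ∀ a → 1ℤ + - a * 0ℤ ≡ 1ℤ
      ring = solve-∀
    high : ∀ k → suc n < k → coeff (fallingPoly (suc n)) k ≡ 0ℤ
    high (suc k) (s≤s n<k) = begin
      coeff (fallingPoly (suc n)) (suc k) ≡⟨ coeff-step k ⟩
      coeff (fallingPoly n) k + - + n * coeff (fallingPoly n) (suc k)
        ≡⟨ cong₂ (λ a b → a + - + n * b) (proj₂ (fallingPoly-monic n) k n<k)
                 (proj₂ (fallingPoly-monic n) (suc k) (ℕ.m<n⇒m<1+n n<k)) ⟩
      0ℤ + - + n * 0ℤ ≡⟨ ring (+ n) ⟩
      0ℤ ∎
      where
      ring : ∀ a → 0ℤ + - a * 0ℤ ≡ 0ℤ
      ring = solve-∀

  Δ : (ℤ → ℤ) → ℤ → ℤ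
  Δ f x = f (x + 1ℤ) - f x

  ∣Δ⇒∣ : ∀ {m f} → m ∣ f 0ℤ → (∀ x → m ∣ Δ f x) → ∀ x → m ∣ f x
  ∣Δ⇒∣ {m} {f} m∣f0 m∣Δf = go
    where
    up : ∀ x → m ∣ f x → m ∣ f (x + 1ℤ)
    up x m∣fx = subst (m ∣_) (ring (f (x + 1ℤ)) (f x)) (∣m∣n⇒∣m+n (m∣Δf x) m∣fx)
      where
      ring : ∀ a b → a - b + b ≡ a
      ring = solve-∀
    down : ∀ x → m ∣ f (x + 1ℤ) → m ∣ f x
    down x m∣fx+1 = subst (m ∣_) (ring (f (x + 1ℤ)) (f x)) (∣m∣n⇒∣m-n m∣fx+1 (m∣Δf x))
      where
      ring : ∀ a b → a - (a - b) ≡ b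
      ring = solve-∀
    go : ∀ x → m ∣ f x
    go (+ zero)     = m∣f0
    go (+ suc n)    = subst (λ y → m ∣ f y) (cong +_ (ℕ.+-comm n 1)) (up (+ n) (go (+ n)))
    go -[1+ zero ]  = down -[1+ zero ] m∣f0
    go -[1+ suc n ] = down -[1+ suc n ] (go -[1+ n ])

  falling-shift : ∀ n x → falling (suc n) (x + 1ℤ) ≡ (x + 1ℤ) * falling n x
  falling-shift zero    x = ring x
    where
    ring : ∀ x → 1ℤ * (x + 1ℤ - 0ℤ) ≡ (x + 1ℤ) * 1ℤ
    ring = solve-∀
  falling-shift (suc n) x = begin
    falling (suc n) (x + 1ℤ) * (x + 1ℤ - (1ℤ + + n)) ≡⟨ cong (_* (x + 1ℤ - (1ℤ + + n))) (falling-shift n x) ⟩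
    (x + 1ℤ) * falling n x * (x + 1ℤ - (1ℤ + + n))   ≡⟨ ring x (+ n) (falling n x) ⟩
    (x + 1ℤ) * (falling n x * (x - + n))             ∎
    where
    ring : ∀ x a q → (x + 1ℤ) * q * (x + 1ℤ - (1ℤ + a)) ≡ (x + 1ℤ) * (q * (x - a))
    ring = solve-∀

  Δ-falling : ∀ n x → Δ (falling (suc n)) x ≡ + suc n * falling n x
  Δ-falling n x = begin
    falling (suc n) (x + 1ℤ) - falling n x * (x - + n) ≡⟨ cong (_- falling n x * (x - + n)) (falling-shift n x) ⟩
    (x + 1ℤ) * falling n x - falling n x * (x - + n)   ≡⟨ ring x (+ n) (falling n x) ⟩
    (1ℤ + + n) * falling n x                           ∎
    where
    ring : ∀ x a q → (x + 1ℤ) * q - q * (x - a) ≡ (1ℤ + a) * q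
    ring = solve-∀

  falling[1+n]0≡0 : ∀ n → falling (suc n) 0ℤ ≡ 0ℤ
  falling[1+n]0≡0 zero    = refl
  falling[1+n]0≡0 (suc n) = cong (_* (0ℤ - + suc n)) (falling[1+n]0≡0 n)

  factorial∣falling : ∀ n x → + (n !) ∣ falling n x
  factorial∣falling zero    x = ∣ᵤ⇒∣ (ℕ.1∣ _)
  factorial∣falling (suc n) = ∣Δ⇒∣
    (subst (+ (suc n !) ∣_) (sym (falling[1+n]0≡0 n)) (∣0 _))
    (λ x → subst₂ _∣_ (sym (pos-* (suc n) (n !))) (sym (Δ-falling n x))
                      (*-monoʳ-∣ (+ suc n) (factorial∣falling n x)))

  data FallingExpansion : ℕ → ℤ → (ℤ → ℤ) → Set where
    constant : ∀ {a f} → (∀ x → f x ≡ a) → FallingExpansion zero a f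
    extend   : ∀ {n a b f r} → FallingExpansion n b r →
               (∀ x → f x ≡ a * falling (suc n) x + r x) → FallingExpansion (suc n) a f

  dropLeading : ℕ → Poly → Poly
  dropLeading n g = g ⊕ - coeff g n • fallingPoly n

  coeff-dropLeading : ∀ n g j →
    coeff (dropLeading n g) j ≡ coeff g j + - coeff g n * coeff (fallingPoly n) j
  coeff-dropLeading n g j = trans (coeff-⊕ g (- coeff g n • fallingPoly n) j)
    (cong (λ v → coeff g j + v) (coeff-• (- coeff g n) (fallingPoly n) j))

  dropLeading-degree : ∀ n g → (∀ j → suc n < j → coeff g j ≡ 0ℤ) →
                       ∀ j → n < j → coeff (dropLeading (suc n) g) j ≡ 0ℤ
  dropLeading-degree n g high j n<j with ℕ.m≤n⇒m<n∨m≡n n<j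
  ... | inj₁ n+1<j = begin
    coeff (dropLeading (suc n) g) j                   ≡⟨ coeff-dropLeading (suc n) g j ⟩
    coeff g j + - a * coeff (fallingPoly (suc n)) j   ≡⟨ cong₂ (λ u v → u + - a * v) (high j n+1<j)
                                                               (proj₂ (fallingPoly-monic (suc n)) j n+1<j) ⟩
    0ℤ + - a * 0ℤ                                     ≡⟨ ring a ⟩
    0ℤ                                                ∎
    where
    a = coeff g (suc n)
    ring : ∀ a → 0ℤ + - a * 0ℤ ≡ 0ℤ
    ring = solve-∀
  ... | inj₂ refl = begin
    coeff (dropLeading (suc n) g) (suc n)             ≡⟨ coeff-dropLeading (suc n) g (suc n) ⟩
    a + - a * coeff (fallingPoly (suc n)) (suc n)
      ≡⟨ cong (λ v → a + - a * v) (proj₁ (fallingPoly-monic (suc n))) ⟩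
    a + - a * 1ℤ                                      ≡⟨ ring a ⟩
    0ℤ                                                ∎
    where
    a = coeff g (suc n)
    ring : ∀ a → a + - a * 1ℤ ≡ 0ℤ
    ring = solve-∀

  eval-dropLeading : ∀ n g x → eval g x ≡ coeff g n * falling n x + eval (dropLeading n g) x
  eval-dropLeading n g x = begin
    eval g x                                            ≡⟨ ring (eval g x) a (falling n x) ⟩
    a * falling n x + (eval g x + - a * falling n x)
      ≡⟨ cong (λ v → a * falling n x + (eval g x + - a * v)) (sym (eval-fallingPoly n x)) ⟩
    a * falling n x + (eval g x + - a * eval (fallingPoly n) x)
      ≡⟨ cong (λ v → a * falling n x + (eval g x + v)) (sym (eval-• (- a) (fallingPoly n) x)) ⟩
    a * falling n x + (eval g x + eval (- a • fallingPoly n) x)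
      ≡⟨ cong (λ v → a * falling n x + v) (sym (eval-⊕ g (- a • fallingPoly n) x)) ⟩
    a * falling n x + eval (dropLeading n g) x          ∎
    where
    a = coeff g n
    ring : ∀ u a q → u ≡ a * q + (u + - a * q)
    ring = solve-∀

  expansion : ∀ n g → (∀ j → n < j → coeff g j ≡ 0ℤ) → FallingExpansion n (coeff g n) (eval g)
  expansion zero    g high = constant (eval-constant g high)
  expansion (suc n) g high =
    extend (expansion n (dropLeading (suc n) g) (dropLeading-degree n g high)) (eval-dropLeading (suc n) g)

  Δ-extend : ∀ {n a f r} → (∀ x → f x ≡ a * falling (suc n) x + r x) →
             ∀ x → Δ f x ≡ a * + suc n * falling n x + Δ r x
  Δ-extend {n} {a} {f} {r} f≡ x = begin
    f (x + 1ℤ) - f x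
      ≡⟨ cong₂ _-_ (f≡ (x + 1ℤ)) (f≡ x) ⟩
    a * falling (suc n) (x + 1ℤ) + r (x + 1ℤ) - (a * falling (suc n) x + r x)
      ≡⟨ ring a (falling (suc n) (x + 1ℤ)) (falling (suc n) x) (r (x + 1ℤ)) (r x) ⟩
    a * Δ (falling (suc n)) x + Δ r x
      ≡⟨ cong (λ v → a * v + Δ r x) (Δ-falling n x) ⟩
    a * (+ suc n * falling n x) + Δ r x
      ≡⟨ cong (_+ Δ r x) (sym (*-assoc a (+ suc n) (falling n x))) ⟩
    a * + suc n * falling n x + Δ r x ∎
    where
    ring : ∀ a u v s t → a * u + s - (a * v + t) ≡ a * (u - v) + (s - t)
    ring = solve-∀

  Δ-expansion : ∀ {n a f} → FallingExpansion (suc n) a f → FallingExpansion n (a * + suc n) (Δ f)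
  Δ-expansion {a = a} {f} (extend {b = b} {r = r} (constant r≡b) f≡) = constant λ x → begin
    Δ f x ≡⟨ Δ-extend {zero} {a} {f} {r} f≡ x ⟩
    a * 1ℤ * 1ℤ + (r (x + 1ℤ) - r x) ≡⟨ cong₂ (λ u v → a * 1ℤ * 1ℤ + (u - v)) (r≡b (x + 1ℤ)) (r≡b x) ⟩
    a * 1ℤ * 1ℤ + (b - b)            ≡⟨ ring a b ⟩
    a * 1ℤ ∎
    where
    ring : ∀ a b → a * 1ℤ * 1ℤ + (b - b) ≡ a * 1ℤ
    ring = solve-∀
  Δ-expansion {a = a} (extend {r = r} e@(extend _ _) f≡) =
    extend (Δ-expansion e) (Δ-extend {a = a} {r = r} f≡)

  null⇒leading∣ : ∀ {m n a f} → FallingExpansion n a f → (∀ x → m ∣ f x) → m ∣ a * + (n !)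
  null⇒leading∣ {m} {a = a} (constant f≡a) m∣f =
    subst (m ∣_) (sym (*-identityʳ a)) (subst (m ∣_) (f≡a 0ℤ) (m∣f 0ℤ))
  null⇒leading∣ {m} {suc n} {a} {f} e@(extend _ _) m∣f =
    subst (m ∣_) leading≡ (null⇒leading∣ (Δ-expansion e) m∣Δf)
    where
    m∣Δf : ∀ x → m ∣ Δ f x
    m∣Δf x = ∣m∣n⇒∣m-n (m∣f (x + 1ℤ)) (m∣f x)
    leading≡ : a * + suc n * + (n !) ≡ a * + (suc n !)
    leading≡ = trans (*-assoc a (+ suc n) (+ (n !))) (cong (a *_) (sym (pos-* (suc n) (n !))))

  monicNull⇒∣factorial : ∀ m n → HasMonicNull m n → m ℕ.∣ n !
  monicNull⇒∣factorial m n (f , f-null , g , (g-top , g-high) , f≡g) =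
    ∣⇒∣ᵤ (subst (+ m ∣_) (*-identityˡ (+ (n !))) (null⇒leading∣ g-expansion g-null))
    where
    g-expansion : FallingExpansion n 1ℤ (eval g)
    g-expansion = subst (λ a → FallingExpansion n a (eval g)) g-top (expansion n g g-high)
    g-null : ∀ x → + m ∣ eval g x
    g-null x = subst (+ m ∣_) (ring (eval f x) (eval g x))
      (∣m∣n⇒∣m-n (∣ᵤ⇒∣ {i = eval f x} (f-null x)) (coeffCong⇒eval∣ m f g f≡g x))
      where
      ring : ∀ u v → u - (u - v) ≡ v
      ring = solve-∀

  ∣factorial⇒monicNull : ∀ m n → m ℕ.∣ n ! → HasMonicNull m n
  ∣factorial⇒monicNull m n m∣n! = fallingPoly n , null , fallingPoly n , fallingPoly-monic n , reflexive
    where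
    null : IsNullMod m (fallingPoly n)
    null x = ∣⇒∣ᵤ (subst (+ m ∣_) (sym (eval-fallingPoly n x)) (∣-trans (∣ᵤ⇒∣ m∣n!) (factorial∣falling n x)))
    reflexive : CoeffCong m (fallingPoly n) (fallingPoly n)
    reflexive k = ∣⇒∣ᵤ (subst (+ m ∣_) (sym (+-inverseʳ (coeff (fallingPoly n) k))) (∣0 (+ m)))

  isOmega1-factorial : ∀ m N → 1 ℕ.≤ N → m ℕ.∣ N ! → (∀ n → n < N → ¬ m ℕ.∣ n !) → IsOmega1 m N
  isOmega1-factorial m N 1≤N m∣N! m∤n! =
    1≤N , ∣factorial⇒monicNull m N m∣N! , λ n _ n<N → m∤n! n n<N ∘ monicNull⇒∣factorial m n

module FactorialValuation {p : ℕ} (p-prime : Prime p) where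

  open import Data.Nat
  open import Data.Nat.Properties
  open import Data.Nat.DivMod using (_/_; _%_; m≡m%n+[m/n]*n; m%n<n; m/n<m)
  open import Data.Nat.Divisibility
  open import Data.Nat.Induction using (<-rec)
  open import Data.Nat.Primality using (Prime; prime⇒nonZero; prime⇒nonTrivial; euclidsLemma)
  open import Data.Nat.Tactic.RingSolver using (solve-∀)
  open import Data.Product using (∃; _,_; proj₁; proj₂)
  open import Data.Sum using ([_,_])
  open import Relation.Nullary using (¬_; yes; no; contradiction)
  open import Relation.Binary.PropositionalEquality hiding ([_])
  open ≡-Reasoning

  instance
    p-nonTrivial : NonTrivial p
    p-nonTrivial = prime⇒nonTrivial p-prime

    p-nonZero : NonZero p
    p-nonZero = prime⇒nonZero p-prime

  p∤1 : ¬ p ∣ 1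
  p∤1 p∣1 = nonTrivial⇒≢1 (∣1⇒≡1 p∣1)

  p∤* : ∀ {u w} → ¬ p ∣ u → ¬ p ∣ w → ¬ p ∣ u * w
  p∤* p∤u p∤w p∣uw = [ p∤u , p∤w ] (euclidsLemma _ _ p-prime p∣uw)

  ^-monoʳ-∣ : ∀ m {a b} → a ≤ b → m ^ a ∣ m ^ b
  ^-monoʳ-∣ m {a} {b} a≤b = divides (m ^ (b ∸ a)) (begin
    m ^ b             ≡⟨ cong (m ^_) (sym (m+[n∸m]≡n a≤b)) ⟩
    m ^ (a + (b ∸ a)) ≡⟨ ^-distribˡ-+-* m a (b ∸ a) ⟩
    m ^ a * m ^ (b ∸ a) ≡⟨ *-comm (m ^ a) (m ^ (b ∸ a)) ⟩
    m ^ (b ∸ a) * m ^ a ∎)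

  infix 4 _≃_

  record _≃_ (a b : ℕ) : Set where
    constructor unit-factor
    field
      unit   : ℕ
      p∤unit : ¬ p ∣ unit
      a≡b*u  : a ≡ b * unit

  ≃-reflexive : ∀ {a b} → a ≡ b → a ≃ b
  ≃-reflexive {a} refl = unit-factor 1 p∤1 (sym (*-identityʳ a))

  ≃-trans : ∀ {a b c} → a ≃ b → b ≃ c → a ≃ c
  ≃-trans {c = c} (unit-factor u p∤u refl) (unit-factor w p∤w refl) =
    unit-factor (w * u) (p∤* p∤w p∤u) (*-assoc c w u)

  *-congˡ-≃ : ∀ c {a b} → a ≃ b → c * a ≃ c * b
  *-congˡ-≃ c {b = b} (unit-factor u p∤u refl) = unit-factor u p∤u (sym (*-assoc c b u))

  unit-*-≃ : ∀ {u a b} → ¬ p ∣ u → a ≃ b → u * a ≃ b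
  unit-*-≃ {u} {b = b} p∤u (unit-factor w p∤w refl) = unit-factor (w * u) (p∤* p∤w p∤u) (ring u b w)
    where
    ring : ∀ u b w → u * (b * w) ≡ b * (w * u)
    ring = solve-∀

  ≃-power-∣⇒≤ : ∀ {a v d} → a ≃ p ^ v → p ^ d ∣ a → d ≤ v
  ≃-power-∣⇒≤ {v = v} {d} (unit-factor u p∤u refl) p^d∣a with d ≤? v
  ... | yes d≤v = d≤v
  ... | no d≰v = contradiction (*-cancelˡ-∣ (p ^ v) {{m^n≢0 p v}} p^v*p∣p^v*u) p∤u
    where
    p^v*p∣p^v*u : p ^ v * p ∣ p ^ v * u
    p^v*p∣p^v*u = subst (_∣ p ^ v * u) (*-comm p (p ^ v)) (∣-trans (^-monoʳ-∣ p (≰⇒> d≰v)) p^d∣a)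

  ≃-power-≤⇒∣ : ∀ {a v d} → a ≃ p ^ v → d ≤ v → p ^ d ∣ a
  ≃-power-≤⇒∣ (unit-factor u _ refl) d≤v = ∣-trans (^-monoʳ-∣ p d≤v) (m∣m*n u)

  ≃-power-unique : ∀ {a v w} → a ≃ p ^ v → a ≃ p ^ w → v ≡ w
  ≃-power-unique {v = v} {w} a≃p^v a≃p^w = ≤-antisym
    (≃-power-∣⇒≤ a≃p^w (≃-power-≤⇒∣ {v = v} a≃p^v ≤-refl))
    (≃-power-∣⇒≤ a≃p^v (≃-power-≤⇒∣ {v = w} a≃p^w ≤-refl))

  [p*q+r]!≃[p*q]! : ∀ q r → r < p → (p * q + r) ! ≃ (p * q) !
  [p*q+r]!≃[p*q]! q zero    _   = ≃-reflexive (cong _! (+-identityʳ (p * q)))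
  [p*q+r]!≃[p*q]! q (suc r) r<p = subst (λ n → n ! ≃ (p * q) !) (sym (+-suc (p * q) r))
    (unit-*-≃ p∤next ([p*q+r]!≃[p*q]! q r (<⇒≤ r<p)))
    where
    p∤next : ¬ p ∣ suc (p * q + r)
    p∤next p∣next = <⇒≱ r<p (∣⇒≤ (∣m+n∣m⇒∣n (subst (p ∣_) (sym (+-suc (p * q) r)) p∣next) (m∣m*n q)))

  [p*q]!≃ : ∀ q → (p * q) ! ≃ p ^ q * q !
  [p*q]!≃ zero    = ≃-reflexive (cong _! (*-zeroʳ p))
  [p*q]!≃ (suc q) = subst (λ n → n ! ≃ p ^ suc q * suc q !) (sym p*[1+q]≡)
    (subst (λ c → c * (p * q + pred p) ! ≃ p ^ suc q * suc q !) p*[1+q]≡ p*[1+q]*[p*q+p-1]!≃)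
    where
    p*[1+q]≡ : p * suc q ≡ suc (p * q + pred p)
    p*[1+q]≡ = begin
      p * suc q            ≡⟨ *-suc p q ⟩
      p + p * q            ≡⟨ cong (_+ p * q) (sym (suc-pred p)) ⟩
      suc (pred p + p * q) ≡⟨ cong suc (+-comm (pred p) (p * q)) ⟩
      suc (p * q + pred p) ∎
    p*[1+q]*[p*q+p-1]!≃ : p * suc q * (p * q + pred p) ! ≃ p ^ suc q * suc q !
    p*[1+q]*[p*q+p-1]!≃ =
      ≃-trans (*-congˡ-≃ (p * suc q) ([p*q+r]!≃[p*q]! q (pred p) (≤-reflexive (suc-pred p))))
      (≃-trans (*-congˡ-≃ (p * suc q) ([p*q]!≃ q))
      (≃-reflexive (ring p q (p ^ q) (q !))))
      where
      ring : ∀ p q w f → p * (1 + q) * (w * f) ≡ p * w * (f + q * f)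
      ring = solve-∀

  [p*q+r]!≃ : ∀ q r → r < p → (p * q + r) ! ≃ p ^ q * q !
  [p*q+r]!≃ q r r<p = ≃-trans ([p*q+r]!≃[p*q]! q r r<p) ([p*q]!≃ q)

  factorial-valuation : ∀ n → ∃ λ v → n ! ≃ p ^ v
  factorial-valuation = <-rec _ go
    where
    go : ∀ n → (∀ {m} → m < n → ∃ λ v → m ! ≃ p ^ v) → ∃ λ v → n ! ≃ p ^ v
    go zero    _   = 0 , ≃-reflexive refl
    go n@(suc _) rec with rec (m/n<m n p (nonTrivial⇒n>1 p))
    ... | v , [n/p]!≃ = n / p + v , ≃-trans n!≃ (≃-trans (*-congˡ-≃ (p ^ (n / p)) [n/p]!≃) p^+≃)
      where
      n≡ : n ≡ p * (n / p) + n % p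
      n≡ = trans (m≡m%n+[m/n]*n n p) (trans (+-comm (n % p) _) (cong (_+ n % p) (*-comm (n / p) p)))
      n!≃ : n ! ≃ p ^ (n / p) * (n / p) !
      n!≃ = subst (λ k → k ! ≃ p ^ (n / p) * (n / p) !) (sym n≡) ([p*q+r]!≃ (n / p) (n % p) (m%n<n n p))
      p^+≃ : p ^ (n / p) * p ^ v ≃ p ^ (n / p + v)
      p^+≃ = ≃-reflexive (sym (^-distribˡ-+-* p (n / p) v))

  ν : ℕ → ℕ
  ν n = proj₁ (factorial-valuation n)

  n!≃p^ν : ∀ n → n ! ≃ p ^ ν n
  n!≃p^ν n = proj₂ (factorial-valuation n)

  ν[p*q+r] : ∀ q r → r < p → ν (p * q + r) ≡ q + ν q
  ν[p*q+r] q r r<p = ≃-power-unique (n!≃p^ν (p * q + r))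
    (≃-trans ([p*q+r]!≃ q r r<p)
    (≃-trans (*-congˡ-≃ (p ^ q) (n!≃p^ν q)) (≃-reflexive (sym (^-distribˡ-+-* p q (ν q))))))

  ν[p*q] : ∀ q → ν (p * q) ≡ q + ν q
  ν[p*q] q = trans (cong ν (sym (+-identityʳ (p * q)))) (ν[p*q+r] q 0 (>-nonZero⁻¹ p))

  ≤ν⇒p^d∣n! : ∀ {d} n → d ≤ ν n → p ^ d ∣ n !
  ≤ν⇒p^d∣n! n = ≃-power-≤⇒∣ (n!≃p^ν n)

  p^d∣n!⇒≤ν : ∀ {d} n → p ^ d ∣ n ! → d ≤ ν n
  p^d∣n!⇒≤ν n = ≃-power-∣⇒≤ (n!≃p^ν n)

  ν-mono : ∀ {m n} → m ≤ n → ν m ≤ ν n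
  ν-mono {m} {n} m≤n = p^d∣n!⇒≤ν n (∣-trans (≤ν⇒p^d∣n! m ≤-refl) (m≤n⇒m!∣n! m≤n))

  ν-0 : ν 0 ≡ 0
  ν-0 = ≃-power-unique (n!≃p^ν 0) (≃-reflexive refl)

module Exponents (k : ℕ) (p-prime : Prime (2+ k)) where

  open import Data.Nat
  open import Data.Nat.Properties
  open import Data.Nat.Divisibility using (_∣_)
  open import Data.Nat.Tactic.RingSolver using (solve-∀)
  open import Data.Bool using (true; false)
  open import Data.List using (List; []; _∷_)
  open import Data.List.Relation.Unary.All using (All; []; _∷_)
  open import Data.Sum using (_⊎_; inj₁; inj₂)
  open import Relation.Nullary using (¬_)
  open import Relation.Nullary.Decidable using (dec-true; dec-false)
  open import Relation.Binary.PropositionalEquality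
  open ≡-Reasoning
  open NullPolynomials using (isOmega1-factorial)
  open FactorialValuation p-prime using (ν; ν-0; ν[p*q+r]; ν[p*q]; ν-mono; ≤ν⇒p^d∣n!; p^d∣n!⇒≤ν)

  -- Written as 2+ k so that p ∸ 1 and the comparisons made by stepE compute.
  p : ℕ
  p = 2+ k

  -- For es = (e₁, e₂, …): value es = Σ eᵢ p^(i-1) and weight es = Σ eᵢ I_p(i).
  value : List ℕ → ℕ
  value []       = 0
  value (x ∷ xs) = x + p * value xs

  weight : List ℕ → ℕ
  weight []       = 0
  weight (x ∷ xs) = value (x ∷ xs) + weight xs

  weightedFrom≡p^s*value : ∀ s es → weightedFrom p s es ≡ p ^ s * value es
  weightedFrom≡p^s*value s []       = sym (*-zeroʳ (p ^ s))
  weightedFrom≡p^s*value s (x ∷ xs) = begin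
    x * p ^ s + weightedFrom p (suc s) xs ≡⟨ cong (x * p ^ s +_) (weightedFrom≡p^s*value (suc s) xs) ⟩
    x * p ^ s + p * p ^ s * value xs      ≡⟨ ring x (p ^ s) p (value xs) ⟩
    p ^ s * (x + p * value xs)            ∎
    where
    ring : ∀ x a p w → x * a + p * a * w ≡ a * (x + p * w)
    ring = solve-∀

  data Overflow : List ℕ → Set where
    here  : ∀ {rest} → All (_< p) rest → Overflow (p ∷ rest)
    there : ∀ {es} → Overflow es → Overflow (0 ∷ es)

  Admissible : List ℕ → Set
  Admissible es = All (_< p) es ⊎ Overflow es

  allLe-digits : ∀ {es} → All (_< p) es → allLe (suc k) es ≡ true
  allLe-digits []                        = refl
  allLe-digits {x ∷ _} (x<p ∷ digits)
    rewrite dec-true (x ≤? suc k) (≤-pred x<p) = allLe-digits digits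

  allLe-overflow : ∀ {es} → Overflow es → allLe (suc k) es ≡ false
  allLe-overflow (here _)          rewrite dec-false (p ≤? suc k) (<-irrefl refl) = refl
  allLe-overflow (there overflow) = allLe-overflow overflow

  stepE-digits : ∀ {es} → All (_< p) es → stepE p es ≡ incHead es
  stepE-digits digits rewrite allLe-digits digits = refl

  stepE-overflow : ∀ {es} → Overflow es → stepE p es ≡ carry p es
  stepE-overflow overflow rewrite allLe-overflow overflow = refl

  carry-here : ∀ rest → carry p (p ∷ rest) ≡ 0 ∷ incHead rest
  carry-here rest rewrite dec-true (p ≟ p) refl = refl

  value-incHead : ∀ es → value (incHead es) ≡ suc (value es)
  value-incHead []      = cong suc (*-zeroʳ p)
  value-incHead (_ ∷ _) = refl

  weight-incHead : ∀ es → weight (incHead es) ≡ suc (weight es)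
  weight-incHead []      = cong suc (trans (+-identityʳ _) (*-zeroʳ p))
  weight-incHead (_ ∷ _) = refl

  incHead-admissible : ∀ {es} → All (_< p) es → Admissible (incHead es)
  incHead-admissible []                 = inj₁ (s≤s (s≤s z≤n) ∷ [])
  incHead-admissible (x<p ∷ digits) with m≤n⇒m<n∨m≡n x<p
  ... | inj₁ x+1<p = inj₁ (x+1<p ∷ digits)
  ... | inj₂ refl  = inj₂ (here digits)

  value-carry-here : ∀ rest → value (0 ∷ incHead rest) ≡ value (p ∷ rest)
  value-carry-here rest = trans (cong (p *_) (value-incHead rest)) (*-suc p (value rest))

  value-carry : ∀ {es} → Overflow es → value (carry p es) ≡ value es
  value-carry (here {rest} _)  rewrite carry-here rest = value-carry-here rest
  value-carry (there overflow) = cong (p *_) (value-carry overflow)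

  weight-carry : ∀ {es} → Overflow es → weight (carry p es) ≡ suc (weight es)
  weight-carry (here {rest} _) rewrite carry-here rest =
    trans (cong₂ _+_ (value-carry-here rest) (weight-incHead rest)) (+-suc _ (weight rest))
  weight-carry (there overflow) =
    trans (cong₂ _+_ (cong (p *_) (value-carry overflow)) (weight-carry overflow)) (+-suc _ _)

  carry-admissible : ∀ {es} → Overflow es → Admissible (carry p es)
  carry-admissible (here {rest} digits) rewrite carry-here rest with incHead-admissible digits
  ... | inj₁ digits′    = inj₁ (s≤s z≤n ∷ digits′)
  ... | inj₂ overflow′  = inj₂ (there overflow′)
  carry-admissible (there overflow) with carry-admissible overflow
  ... | inj₁ digits′    = inj₁ (s≤s z≤n ∷ digits′)
  ... | inj₂ overflow′  = inj₂ (there overflow′)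

  stepE-admissible : ∀ {es} → Admissible es → Admissible (stepE p es)
  stepE-admissible (inj₁ digits)   rewrite stepE-digits digits     = incHead-admissible digits
  stepE-admissible (inj₂ overflow) rewrite stepE-overflow overflow = carry-admissible overflow

  weight-stepE : ∀ {es} → Admissible es → weight (stepE p es) ≡ suc (weight es)
  weight-stepE {es} (inj₁ digits)  rewrite stepE-digits digits     = weight-incHead es
  weight-stepE (inj₂ overflow)     rewrite stepE-overflow overflow = weight-carry overflow

  e-admissible : ∀ d → Admissible (e p d)
  e-admissible zero    = inj₁ []
  e-admissible (suc d) = stepE-admissible (e-admissible d)

  weight-e : ∀ d → weight (e p d) ≡ d
  weight-e zero    = refl
  weight-e (suc d) = trans (weight-stepE (e-admissible d)) (cong suc (weight-e d))

  weight≤ν : ∀ es → weight es ≤ ν (p * value es)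
  weight≤ν []       = z≤n
  weight≤ν (x ∷ xs) = subst (weight (x ∷ xs) ≤_) (sym (ν[p*q] (value (x ∷ xs))))
    (+-monoʳ-≤ (value (x ∷ xs)) (≤-trans (weight≤ν xs) (ν-mono (m≤n+m (p * value xs) x))))

  ν≡weight : ∀ {es} → All (_< p) es → ν (p * value es) ≡ weight es
  ν≡weight []                   = trans (cong ν (*-zeroʳ p)) ν-0
  ν≡weight {x ∷ xs} (x<p ∷ digits) = begin
    ν (p * value (x ∷ xs))                    ≡⟨ ν[p*q] (value (x ∷ xs)) ⟩
    value (x ∷ xs) + ν (x + p * value xs)     ≡⟨ cong (λ n → value (x ∷ xs) + ν n) (+-comm x (p * value xs)) ⟩
    value (x ∷ xs) + ν (p * value xs + x)     ≡⟨ cong (value (x ∷ xs) +_) (ν[p*q+r] (value xs) x x<p) ⟩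
    value (x ∷ xs) + (value xs + ν (value xs)) ≡⟨ cong (value (x ∷ xs) +_) (sym (ν[p*q] (value xs))) ⟩
    value (x ∷ xs) + ν (p * value xs)         ≡⟨ cong (value (x ∷ xs) +_) (ν≡weight digits) ⟩
    value (x ∷ xs) + weight xs                ∎

  -- deg 𝓗_{p,d}, as deg 𝓖_{p,i} = p^i.
  degreeH : ℕ → ℕ
  degreeH d = p * value (e p d)

  ν[pred-degreeH]≤ : ∀ d → ν (pred (degreeH (suc d))) ≤ d
  ν[pred-degreeH]≤ d with e-admissible d
  ν[pred-degreeH]≤ d       | inj₁ digits = ≤-reflexive (begin
    ν (pred (p * value (stepE p es)))  ≡⟨ cong (λ l → ν (pred (p * value l))) (stepE-digits digits) ⟩
    ν (pred (p * value (incHead es)))  ≡⟨ cong (λ w → ν (pred (p * w))) (value-incHead es) ⟩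
    ν (pred (p * suc (value es)))      ≡⟨ cong (λ n → ν (pred n)) (*-suc p (value es)) ⟩
    ν (suc k + p * value es)           ≡⟨ cong ν (+-comm (suc k) (p * value es)) ⟩
    ν (p * value es + suc k)           ≡⟨ ν[p*q+r] (value es) (suc k) ≤-refl ⟩
    value es + ν (value es)            ≡⟨ ν[p*q] (value es) ⟨
    ν (p * value es)                   ≡⟨ ν≡weight digits ⟩
    weight es                          ≡⟨ weight-e d ⟩
    d                                  ∎)
    where
    es = e p d
  ν[pred-degreeH]≤ (suc d) | inj₂ overflow =
    m≤n⇒m≤1+n (subst (λ w → ν (pred (p * w)) ≤ d) (sym value-step) (ν[pred-degreeH]≤ d))
    where
    value-step : value (e p (2+ d)) ≡ value (e p (suc d))
    value-step = trans (cong value (stepE-overflow overflow)) (value-carry overflow)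

  isOmega1-degreeH : ∀ d → IsOmega1 (p ^ suc d) (degreeH (suc d))
  isOmega1-degreeH d = isOmega1-factorial (p ^ suc d) N 1≤N (≤ν⇒p^d∣n! N 1+d≤νN) p^[1+d]∤n!
    where
    N = degreeH (suc d)
    1+d≤νN : suc d ≤ ν N
    1+d≤νN = subst (_≤ ν N) (weight-e (suc d)) (weight≤ν (e p (suc d)))
    1≤N : 1 ≤ N
    1≤N = n≢0⇒n>0 λ N≡0 → <⇒≱ (s≤s z≤n) (subst (λ n → suc d ≤ ν n) N≡0 1+d≤νN)
    p^[1+d]∤n! : ∀ n → n < N → ¬ p ^ suc d ∣ n !
    p^[1+d]∤n! n n<N p^[1+d]∣n! =
      <⇒≱ (s≤s (ν[pred-degreeH]≤ d)) (≤-trans (p^d∣n!⇒≤ν n p^[1+d]∣n!) (ν-mono (<⇒≤pred n<N)))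

  sumEP≡ : ∀ es → sumEP p es ≡ p * value es
  sumEP≡ es = trans (weightedFrom≡p^s*value 1 es) (cong (_* value es) (*-identityʳ p))

  sumEP′≡ : ∀ es → sumEP' p es ≡ value es
  sumEP′≡ es = trans (weightedFrom≡p^s*value 0 es) (*-identityˡ (value es))

open import Data.Nat using (_≤_; _^_; _*_)
open import Data.Product using (_×_; _,_)
open import Relation.Binary.PropositionalEquality using (_≡_; sym; trans; cong; subst)
open import Data.Nat.Primality using (¬prime[0]; ¬prime[1])
open import Data.Empty using (⊥-elim)

mainTheorem2 : ∀ (p : ℕ) → Prime p → ∀ (d : ℕ) → 1 ≤ d →
    IsOmega1 (p ^ d) (sumEP p (e p d)) × sumEP p (e p d) ≡ p * sumEP' p (e p d)
mainTheorem2 0      p-prime = ⊥-elim (¬prime[0] p-prime)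
mainTheorem2 1      p-prime = ⊥-elim (¬prime[1] p-prime)
mainTheorem2 (2+ k) p-prime (suc d) _ =
  subst (IsOmega1 (p ^ suc d)) (sym (sumEP≡ es)) (isOmega1-degreeH d) ,
  trans (sumEP≡ es) (cong (p *_) (sym (sumEP′≡ es)))
  where
  open Exponents k p-prime
  es = e p (suc d)
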